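{- Let $\{P_n\}_{n\geq 0}$ be defined by $P_0=1$, $P_1=8$, $(n+1)^2P_{n+1}=8(3n^2+3n+1)P_n-128n^2P_{n-1}$ for $n\geq 1$, and let $\{V_n\}_{n\geq 0}$ be defined by $V_0=1$, $V_1=8$, $n(n+1)^2 V_{n+1}=8n(3n^2+5n+1)V_n-128(n-1)(n+1)^2V_{n-1}$ for $n\geq 1$. Then both sequences $\{\sqrt[n]{P_n}\}_{n\geq 1}$ and $\{\sqrt[n]{V_n}\}_{n\geq 1}$ are strictly increasing. -}

module Defs where

open import Data.Nat as ℕ using (ℕ; zero; suc)
open import Data.Integer as ℤ using (ℤ; +_)
open import Data.Rational using (ℚ; _/_; _+_; _-_; _*_; 1ℚ)

⟦_⟧ : ℕ → ℚ
⟦ k ⟧ = (+ k) / 1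

_^ℚ_ : ℚ → ℕ → ℚ
p ^ℚ zero = 1ℚ
p ^ℚ suc k = p * (p ^ℚ k)

P : ℕ → ℚ
P zero = ⟦ 1 ⟧
P (suc zero) = ⟦ 8 ⟧
P (suc (suc n)) =
  let m = suc n in
  (⟦ 8 ℕ.* (3 ℕ.* m ℕ.* m ℕ.+ 3 ℕ.* m ℕ.+ 1) ⟧ * P (suc n)
    - ⟦ 128 ℕ.* m ℕ.* m ⟧ * P n)
  * ((+ 1) / (suc m ℕ.* suc m))

V : ℕ → ℚ
V zero = ⟦ 1 ⟧
V (suc zero) = ⟦ 8 ⟧
V (suc (suc n)) =
  let m = suc n in
  (⟦ 8 ℕ.* m ℕ.* (3 ℕ.* m ℕ.* m ℕ.+ 5 ℕ.* m ℕ.+ 1) ⟧ * V (suc n)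
    - ⟦ 128 ℕ.* n ℕ.* (suc m ℕ.* suc m) ⟧ * V n)
  * ((+ 1) / (m ℕ.* (suc m ℕ.* suc m)))

-- The sequence (a_n^{1/n})_{n ≥ 1} is well defined (a_n > 0) and strictly
-- increasing:  for n ≥ 1,  a_n > 0  and  a_n^{1/n} < a_{n+1}^{1/(n+1)},
-- the latter being equivalent (for positive a_n, a_{n+1}) to
-- a_n^{n+1} < a_{n+1}^n.
RootStrictlyIncreasing : (ℕ → ℚ) → Set
RootStrictlyIncreasing a =
  (n : ℕ) → 1 ℕ.≤ n →
  (Data.Rational._<_ (⟦ 0 ⟧) (a n)) Data.Product.×
  Data.Rational._<_ (a n ^ℚ suc n) (a (suc n) ^ℚ n)
  where import Data.Product

-- Both sequences are controlled through the ratios of consecutive terms.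
-- For P one shows by induction that 8 ≤ P (n+1) / P n ≤ 16 (n+1) / (n+2); under these
-- bounds the recurrence makes P strictly log-convex, and the n-th roots of a positive
-- log-convex sequence with P 0 ≤ 1 increase strictly.  For V one shows, for n ≥ 1,
-- 16 < V (n+1) / V n ≤ 16 (n+1)² / (n (n+2)); telescoping the upper bound gives
-- V n ≤ n 16ⁿ / (n+1) < 16ⁿ, so the n-th root of V n stays below 16 while every ratio
-- exceeds 16, which forces the roots up.  Each inductive step is an exact identity,
-- obtained from the recurrence, expressing the new slack as a nonnegative combination
-- of the old ones.
{-# OPTIONS --safe #-}
module Submission where

open import Defs
open import Algebra.Properties.Group using (∙-cancelʳ)
open import Data.Integer as ℤ using (+_)
import Data.Integer.Properties as ℤ
open import Data.List using ([]; _∷_)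
open import Data.Nat as ℕ using (ℕ; zero; suc)
import Data.Nat.Coprimality as Coprime
import Data.Nat.Literals as ℕ
open import Data.Product using (_×_; _,_; proj₁; proj₂)
open import Data.Rational
  using (ℚ; mkℚ; _/_; _+_; _-_; -_; _*_; 0ℚ; _<_; _≤_; _≟_; positive; nonNegative)
import Data.Rational.Literals as ℚ
import Data.Rational.Properties as ℚ
open import Data.Unit using (tt)
open import Function using (_∘_)
open import Relation.Binary.PropositionalEquality
open import Relation.Nullary.Decidable using (dec⇒maybe; from-yes)
open import Tactic.RingSolver using (solve; solve-∀)
open import Tactic.RingSolver.Core.AlmostCommutativeRing
  using (AlmostCommutativeRing; fromCommutativeRing)

open import Agda.Builtin.FromNat using (fromNat)

instance
  _ = ℕ.number
  _ = ℚ.number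

ℚ-ring : AlmostCommutativeRing _ _
ℚ-ring = fromCommutativeRing ℚ.+-*-commutativeRing (dec⇒maybe ∘ (0ℚ ≟_))

-- The identities below follow from a recurrence u ≡ v by naming the multiplier k that
-- makes L − R = k (u − v) a ring identity, which the solver then checks.
by-multiple-of : ∀ {L R u v} k → u ≡ v → L + k * v ≡ R + k * u → L ≡ R
by-multiple-of {L} {R} {u} k refl = ∙-cancelʳ ℚ.+-0-group (k * u) L R

⟦⟧≡mkℚ : ∀ n → ⟦ n ⟧ ≡ mkℚ (+ n) 0 (Coprime.sym (Coprime.1-coprimeTo n))
⟦⟧≡mkℚ n = ℚ.normalize-coprime (Coprime.sym (Coprime.1-coprimeTo n))

⟦+⟧ : ∀ m n → ⟦ m ℕ.+ n ⟧ ≡ ⟦ m ⟧ + ⟦ n ⟧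
⟦+⟧ m n = begin
  + (m ℕ.+ n) / 1                    ≡⟨ cong (_/ 1) (ℤ.pos-+ m n) ⟩
  (+ m ℤ.+ + n) / 1                  ≡⟨ cong₂ (λ i j → (i ℤ.+ j) / 1) (ℤ.*-identityʳ (+ m)) (ℤ.*-identityʳ (+ n)) ⟨
  (+ m ℤ.* + 1 ℤ.+ + n ℤ.* + 1) / 1  ≡⟨ cong₂ _+_ (⟦⟧≡mkℚ m) (⟦⟧≡mkℚ n) ⟨
  ⟦ m ⟧ + ⟦ n ⟧                      ∎
  where open ≡-Reasoning

⟦*⟧ : ∀ m n → ⟦ m ℕ.* n ⟧ ≡ ⟦ m ⟧ * ⟦ n ⟧
⟦*⟧ m n = begin
  + (m ℕ.* n) / 1   ≡⟨ cong (_/ 1) (ℤ.pos-* m n) ⟩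
  (+ m ℤ.* + n) / 1 ≡⟨ cong₂ _*_ (⟦⟧≡mkℚ m) (⟦⟧≡mkℚ n) ⟨
  ⟦ m ⟧ * ⟦ n ⟧     ∎
  where open ≡-Reasoning

⟦suc⟧ : ∀ n → ⟦ suc n ⟧ ≡ 1 + ⟦ n ⟧
⟦suc⟧ = ⟦+⟧ 1

⟦⟧-nonNeg : ∀ n → 0 ≤ ⟦ n ⟧
⟦⟧-nonNeg n = ℚ.nonNegative⁻¹ _ {{ℚ.normalize-nonNeg n 1}}

⟦suc⟧-pos : ∀ n → 0 < ⟦ suc n ⟧
⟦suc⟧-pos n = ℚ.positive⁻¹ _ {{ℚ.normalize-pos (suc n) 1}}

⟦d⟧*[p*1/d]≡p : ∀ d .{{_ : ℕ.NonZero d}} p → ⟦ d ⟧ * (p * (+ 1 / d)) ≡ p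
⟦d⟧*[p*1/d]≡p d@(suc _) p = begin
  ⟦ d ⟧ * (p * (+ 1 / d))  ≡⟨ x[yz]≡y[xz] ⟦ d ⟧ p (+ 1 / d) ⟩
  p * (⟦ d ⟧ * (+ 1 / d))  ≡⟨ cong (p *_) ⟦d⟧*1/d≡1 ⟩
  p * 1                    ≡⟨ ℚ.*-identityʳ p ⟩
  p                        ∎
  where
  open ≡-Reasoning
  x[yz]≡y[xz] : ∀ x y z → x * (y * z) ≡ y * (x * z)
  x[yz]≡y[xz] = solve-∀ ℚ-ring
  ⟦d⟧*1/d≡1 : ⟦ d ⟧ * (+ 1 / d) ≡ 1
  ⟦d⟧*1/d≡1 = trans (cong₂ _*_ (⟦⟧≡mkℚ d) (ℚ.normalize-coprime (Coprime.1-coprimeTo d)))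
                    (ℚ.*-inverseʳ (mkℚ (+ d) 0 (Coprime.sym (Coprime.1-coprimeTo d))))

infixl 6 _⊕_
infixl 7 _⊗_

data Poly : Set where
  X   : Poly
  lit : ℕ → Poly
  _⊕_ _⊗_ : Poly → Poly → Poly

evalℕ : Poly → ℕ → ℕ
evalℕ X       n = n
evalℕ (lit k) n = k
evalℕ (e ⊕ f) n = evalℕ e n ℕ.+ evalℕ f n
evalℕ (e ⊗ f) n = evalℕ e n ℕ.* evalℕ f n

evalℚ : Poly → ℚ → ℚ
evalℚ X       x = x
evalℚ (lit k) x = ⟦ k ⟧
evalℚ (e ⊕ f) x = evalℚ e x + evalℚ f x
evalℚ (e ⊗ f) x = evalℚ e x * evalℚ f x

⟦evalℕ⟧≡evalℚ : ∀ e n → ⟦ evalℕ e n ⟧ ≡ evalℚ e ⟦ n ⟧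
⟦evalℕ⟧≡evalℚ X       n = refl
⟦evalℕ⟧≡evalℚ (lit k) n = refl
⟦evalℕ⟧≡evalℚ (e ⊕ f) n =
  trans (⟦+⟧ (evalℕ e n) (evalℕ f n)) (cong₂ _+_ (⟦evalℕ⟧≡evalℚ e n) (⟦evalℕ⟧≡evalℚ f n))
⟦evalℕ⟧≡evalℚ (e ⊗ f) n =
  trans (⟦*⟧ (evalℕ e n) (evalℕ f n)) (cong₂ _*_ (⟦evalℕ⟧≡evalℚ e n) (⟦evalℕ⟧≡evalℚ f n))

-- With d, α, β the ℕ-polynomials appearing in the definition of P (resp. V), the
-- left-hand side is d(n) times the unfolded P (2 + n) (resp. V (2 + n)).
cast-recurrence : ∀ (d α β : Poly) n {u v : ℚ} .{{_ : ℕ.NonZero (evalℕ d n)}} →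
  evalℚ d ⟦ n ⟧ * ((⟦ evalℕ α n ⟧ * v - ⟦ evalℕ β n ⟧ * u) * (+ 1 / evalℕ d n))
    ≡ evalℚ α ⟦ n ⟧ * v - evalℚ β ⟦ n ⟧ * u
cast-recurrence d α β n {u} {v} = begin
  evalℚ d ⟦ n ⟧ * (w * 1/d)               ≡⟨ cong (_* (w * 1/d)) (⟦evalℕ⟧≡evalℚ d n) ⟨
  ⟦ evalℕ d n ⟧ * (w * 1/d)               ≡⟨ ⟦d⟧*[p*1/d]≡p (evalℕ d n) w ⟩
  w                                       ≡⟨ cong₂ (λ p q → p * v - q * u) (⟦evalℕ⟧≡evalℚ α n) (⟦evalℕ⟧≡evalℚ β n) ⟩
  evalℚ α ⟦ n ⟧ * v - evalℚ β ⟦ n ⟧ * u  ∎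
  where
  open ≡-Reasoning
  w = ⟦ evalℕ α n ⟧ * v - ⟦ evalℕ β n ⟧ * u
  1/d = + 1 / evalℕ d n

P-Recurrence : ℚ → ℚ → ℚ → ℚ → Set
P-Recurrence x a b c =
  (2 + x) * (2 + x) * c ≡ 8 * (3 * (1 + x) * (1 + x) + 3 * (1 + x) + 1) * b - 128 * (1 + x) * (1 + x) * a

P-rec : ∀ n → P-Recurrence ⟦ n ⟧ (P n) (P (suc n)) (P (suc (suc n)))
P-rec n = cast-recurrence (m′ ⊗ m′) (lit 8 ⊗ (lit 3 ⊗ m ⊗ m ⊕ lit 3 ⊗ m ⊕ lit 1)) (lit 128 ⊗ m ⊗ m) n
  where m  = lit 1 ⊕ X
        m′ = lit 2 ⊕ X

V-Recurrence : ℚ → ℚ → ℚ → ℚ → Set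
V-Recurrence x a b c =
  (1 + x) * ((2 + x) * (2 + x)) * c
    ≡ 8 * (1 + x) * (3 * (1 + x) * (1 + x) + 5 * (1 + x) + 1) * b - 128 * x * ((2 + x) * (2 + x)) * a

V-rec : ∀ n → V-Recurrence ⟦ n ⟧ (V n) (V (suc n)) (V (suc (suc n)))
V-rec n =
  cast-recurrence (m ⊗ (m′ ⊗ m′)) (lit 8 ⊗ m ⊗ (lit 3 ⊗ m ⊗ m ⊕ lit 5 ⊗ m ⊕ lit 1)) (lit 128 ⊗ X ⊗ (m′ ⊗ m′)) n
  where m  = lit 1 ⊕ X
        m′ = lit 2 ⊕ X

*-nonNeg : ∀ {p q} → 0 ≤ p → 0 ≤ q → 0 ≤ p * q
*-nonNeg {p} {q} 0≤p 0≤q =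
  ℚ.nonNegative⁻¹ (p * q) {{ℚ.nonNeg*nonNeg⇒nonNeg p {{nonNegative 0≤p}} q {{nonNegative 0≤q}}}}

*-pos : ∀ {p q} → 0 < p → 0 < q → 0 < p * q
*-pos {p} {q} 0<p 0<q = ℚ.positive⁻¹ (p * q) {{ℚ.pos*pos⇒pos p {{positive 0<p}} q {{positive 0<q}}}}

p≤q⇒0≤q-p : ∀ {p q} → p ≤ q → 0 ≤ q - p
p≤q⇒0≤q-p {p} {q} p≤q = subst (_≤ q - p) (ℚ.+-inverseʳ p) (ℚ.+-monoˡ-≤ (- p) p≤q)

q-p+p≡q : ∀ p q → q - p + p ≡ q
q-p+p≡q = solve-∀ ℚ-ring

≤-by-certificate : ∀ {k p q e} → 0 < k → k * (q - p) ≡ e → 0 ≤ e → p ≤ q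
≤-by-certificate {k} {p} {q} 0<k refl 0≤e =
  subst₂ _≤_ (ℚ.+-identityˡ p) (q-p+p≡q p q) (ℚ.+-monoˡ-≤ p 0≤q-p)
  where
  0≤q-p : 0 ≤ q - p
  0≤q-p = ℚ.*-cancelˡ-≤-pos k {{positive 0<k}} (subst (_≤ k * (q - p)) (sym (ℚ.*-zeroʳ k)) 0≤e)

<-by-certificate : ∀ {k p q e} → 0 < k → k * (q - p) ≡ e → 0 < e → p < q
<-by-certificate {k} {p} {q} 0<k refl 0<e =
  subst₂ _<_ (ℚ.+-identityˡ p) (q-p+p≡q p q) (ℚ.+-monoˡ-< p 0<q-p)
  where
  0<q-p : 0 < q - p
  0<q-p = ℚ.*-cancelˡ-<-nonNeg k {{nonNegative (ℚ.<⇒≤ 0<k)}} (subst (_< k * (q - p)) (sym (ℚ.*-zeroʳ k)) 0<e)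

^ℚ-nonNeg : ∀ {p} n → 0 ≤ p → 0 ≤ p ^ℚ n
^ℚ-nonNeg zero    0≤p = ℚ.nonNegative⁻¹ 1
^ℚ-nonNeg (suc n) 0≤p = *-nonNeg 0≤p (^ℚ-nonNeg n 0≤p)

^ℚ-pos : ∀ {p} n → 0 < p → 0 < p ^ℚ n
^ℚ-pos zero    0<p = ℚ.positive⁻¹ 1
^ℚ-pos (suc n) 0<p = *-pos 0<p (^ℚ-pos n 0<p)

^ℚ-distrib-* : ∀ p q n → (p * q) ^ℚ n ≡ p ^ℚ n * q ^ℚ n
^ℚ-distrib-* p q zero    = refl
^ℚ-distrib-* p q (suc n) = trans (cong (p * q *_) (^ℚ-distrib-* p q n)) (xy[XY]≡xX[yY] p q (p ^ℚ n) (q ^ℚ n))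
  where
  xy[XY]≡xX[yY] : ∀ x y X Y → x * y * (X * Y) ≡ x * X * (y * Y)
  xy[XY]≡xX[yY] = solve-∀ ℚ-ring

^ℚ-mono-≤ : ∀ {p q} n → 0 ≤ p → p ≤ q → p ^ℚ n ≤ q ^ℚ n
^ℚ-mono-≤ zero    0≤p p≤q = ℚ.≤-refl
^ℚ-mono-≤ {p} {q} (suc n) 0≤p p≤q = ℚ.≤-trans
  (ℚ.*-monoʳ-≤-nonNeg (p ^ℚ n) {{nonNegative (^ℚ-nonNeg n 0≤p)}} p≤q)
  (ℚ.*-monoˡ-≤-nonNeg q {{nonNegative (ℚ.≤-trans 0≤p p≤q)}} (^ℚ-mono-≤ n 0≤p p≤q))

^ℚ-mono-< : ∀ {p q} n → 0 ≤ p → p < q → p ^ℚ suc n < q ^ℚ suc n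
^ℚ-mono-< {p} {q} n 0≤p p<q = ℚ.≤-<-trans
  (ℚ.*-monoˡ-≤-nonNeg p {{nonNegative 0≤p}} (^ℚ-mono-≤ n 0≤p (ℚ.<⇒≤ p<q)))
  (ℚ.*-monoˡ-<-pos (q ^ℚ n) {{positive (^ℚ-pos n (ℚ.≤-<-trans 0≤p p<q))}} p<q)

logConvex⇒RootStrictlyIncreasing : (a : ℕ → ℚ) → a 0 ≤ 1 → (∀ n → 0 < a n) →
  (∀ n → a (suc n) * a (suc n) < a n * a (suc (suc n))) → RootStrictlyIncreasing a
logConvex⇒RootStrictlyIncreasing a a₀≤1 pos logConvex (suc n) _ = pos (suc n) , step n (weak n)
  where
  Weak : ℕ → Set
  Weak n = a n ^ℚ suc n ≤ a (suc n) ^ℚ n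

  step : ∀ n → Weak n → a (suc n) ^ℚ suc (suc n) < a (suc (suc n)) ^ℚ suc n
  step n weak-n = ℚ.*-cancelˡ-<-nonNeg (q ^ℚ n) {{nonNegative (^ℚ-nonNeg n 0≤q)}} (begin-strict
    q ^ℚ n * q ^ℚ suc (suc n)  ≡⟨ qⁿq²⁺ⁿ≡[qq]¹⁺ⁿ ⟩
    (q * q) ^ℚ suc n           <⟨ ^ℚ-mono-< n (*-nonNeg 0≤q 0≤q) (logConvex n) ⟩
    (p * r) ^ℚ suc n           ≡⟨ ^ℚ-distrib-* p r (suc n) ⟩
    p ^ℚ suc n * r ^ℚ suc n    ≤⟨ ℚ.*-monoʳ-≤-nonNeg (r ^ℚ suc n) {{nonNegative (^ℚ-nonNeg (suc n) 0≤r)}} weak-n ⟩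
    q ^ℚ n * r ^ℚ suc n        ∎)
    where
    open ℚ.≤-Reasoning
    p = a n
    q = a (suc n)
    r = a (suc (suc n))
    0≤q = ℚ.<⇒≤ (pos (suc n))
    0≤r = ℚ.<⇒≤ (pos (suc (suc n)))
    x[y[yx]]≡yx[yx] : ∀ x y → x * (y * (y * x)) ≡ y * x * (y * x)
    x[y[yx]]≡yx[yx] = solve-∀ ℚ-ring
    qⁿq²⁺ⁿ≡[qq]¹⁺ⁿ : q ^ℚ n * q ^ℚ suc (suc n) ≡ (q * q) ^ℚ suc n
    qⁿq²⁺ⁿ≡[qq]¹⁺ⁿ = trans (x[y[yx]]≡yx[yx] (q ^ℚ n) q) (sym (^ℚ-distrib-* q q (suc n)))

  weak : ∀ n → Weak n
  weak zero    = subst (_≤ 1) (sym (ℚ.*-identityʳ (a 0))) a₀≤1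
  weak (suc n) = ℚ.<⇒≤ (step n (weak n))

root<r≤ratio⇒RootStrictlyIncreasing : (a : ℕ → ℚ) {r : ℚ} → 0 ≤ r → (∀ n → 0 < a (suc n)) →
  (∀ n → a (suc n) < r ^ℚ suc n) → (∀ n → r * a (suc n) ≤ a (suc (suc n))) → RootStrictlyIncreasing a
root<r≤ratio⇒RootStrictlyIncreasing a {r} 0≤r pos root<r r≤ratio (suc n) _ = pos n , (begin-strict
  a′ * a′ ^ℚ suc n          <⟨ ℚ.*-monoˡ-<-pos (a′ ^ℚ suc n) {{positive (^ℚ-pos (suc n) (pos n))}} (root<r n) ⟩
  r ^ℚ suc n * a′ ^ℚ suc n  ≡⟨ ^ℚ-distrib-* r a′ (suc n) ⟨
  (r * a′) ^ℚ suc n        ≤⟨ ^ℚ-mono-≤ (suc n) (*-nonNeg 0≤r (ℚ.<⇒≤ (pos n))) (r≤ratio n) ⟩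
  a (suc (suc n)) ^ℚ suc n ∎)
  where
  open ℚ.≤-Reasoning
  a′ = a (suc n)

P-RatioBounds : ℚ → ℚ → ℚ → Set
P-RatioBounds x a b = 0 < a × 8 * a ≤ b × (2 + x) * b ≤ 16 * (1 + x) * a

P-logConvex-identity : ∀ x a b c → P-Recurrence x a b c →
  (2 + x) * (2 + x) * (2 + x) * (a * c - b * b)
    ≡ ((2 + x) * (2 + x) * (b - 8 * a) + 8 * (1 + x) * a) * (16 * (1 + x) * a - (2 + x) * b)
      + 128 * (1 + x) * a * a
P-logConvex-identity x a b c rec = by-multiple-of ((2 + x) * a) rec (solve (x ∷ a ∷ b ∷ c ∷ []) ℚ-ring)

P-lower-identity : ∀ x a b c → P-Recurrence x a b c →
  (2 + x) * (2 + x) * (c - 8 * b) ≡ 8 * (1 + x) * ((3 + 2 * x) * (b - 8 * a) + 8 * a)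
P-lower-identity x a b c rec = by-multiple-of 1 rec (solve (x ∷ a ∷ b ∷ c ∷ []) ℚ-ring)

P-upper-identity : ∀ x a b c → P-Recurrence x a b c →
  (2 + x) * (2 + x) * (2 + x) * (16 * (1 + (1 + x)) * b - (2 + (1 + x)) * c)
    ≡ 8 * (1 + x) * ((1 + x) * (1 + x) + 3 * (1 + x) + 1) * (16 * (1 + x) * a - (2 + x) * b)
      + 128 * (1 + x) * (1 + x) * a
P-upper-identity x a b c rec = by-multiple-of ((2 + x) * (3 + x)) (sym rec) (solve (x ∷ a ∷ b ∷ c ∷ []) ℚ-ring)

V-RatioBounds : ℚ → ℚ → ℚ → Set
V-RatioBounds x a b = 0 < a × 16 * a < b × x * (2 + x) * b ≤ 16 * ((1 + x) * (1 + x)) * a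

V-lower-identity : ∀ x a b c → V-Recurrence x a b c →
  (1 + x) * ((2 + x) * (2 + x)) * (c - 16 * b) ≡ 8 * x * ((2 + x) * (2 + x)) * (b - 16 * a) + 8 * b
V-lower-identity x a b c rec = by-multiple-of 1 rec (solve (x ∷ a ∷ b ∷ c ∷ []) ℚ-ring)

V-upper-identity : ∀ x a b c → V-Recurrence x a b c →
  (1 + x) * ((1 + x) * ((2 + x) * (2 + x)))
      * (16 * ((1 + (1 + x)) * (1 + (1 + x))) * b - (1 + x) * (2 + (1 + x)) * c)
    ≡ 8 * (x * (2 + x) * (x * (2 + x)) + x * (5 + x) + 5) * b
      + 8 * x * ((2 + x) * (2 + x)) * (3 + x) * (16 * ((1 + x) * (1 + x)) * a - x * (2 + x) * b)
V-upper-identity x a b c rec =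
  by-multiple-of ((1 + x) * (1 + x) * (3 + x)) (sym rec) (solve (x ∷ a ∷ b ∷ c ∷ []) ℚ-ring)

module _ {x : ℚ} (0≤x : 0 ≤ x) where
  private
    0<1+x : 0 < 1 + x
    0<1+x = ℚ.+-mono-<-≤ (ℚ.positive⁻¹ 1) 0≤x
    0<2+x : 0 < 2 + x
    0<2+x = ℚ.+-mono-<-≤ (ℚ.positive⁻¹ 2) 0≤x
    0<3+x : 0 < 3 + x
    0<3+x = ℚ.+-mono-<-≤ (ℚ.positive⁻¹ 3) 0≤x
    0≤1+x = ℚ.<⇒≤ 0<1+x
    0≤2+x = ℚ.<⇒≤ 0<2+x

  P-logConvex-step : ∀ {a b c} → P-Recurrence x a b c → P-RatioBounds x a b → b * b < a * c
  P-logConvex-step {a} {b} {c} rec (0<a , 8a≤b , upper) =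
    <-by-certificate (*-pos (*-pos 0<2+x 0<2+x) 0<2+x) (P-logConvex-identity x a b c rec)
      (ℚ.+-mono-≤-< (*-nonNeg (ℚ.+-mono-≤ (*-nonNeg (*-nonNeg 0≤2+x 0≤2+x) 0≤t)
                                           (*-nonNeg (*-nonNeg (ℚ.nonNegative⁻¹ 8) 0≤1+x) (ℚ.<⇒≤ 0<a)))
                              0≤s)
                    (*-pos (*-pos (*-pos (ℚ.positive⁻¹ 128) 0<1+x) 0<a) 0<a))
    where
    0≤t = p≤q⇒0≤q-p 8a≤b
    0≤s = p≤q⇒0≤q-p upper

  P-ratioBounds-step : ∀ {a b c} → P-Recurrence x a b c → P-RatioBounds x a b → P-RatioBounds (1 + x) b c
  P-ratioBounds-step {a} {b} {c} rec (0<a , 8a≤b , upper) = 0<b , 8b≤c , upper′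
    where
    0≤a = ℚ.<⇒≤ 0<a
    0≤t = p≤q⇒0≤q-p 8a≤b
    0≤s = p≤q⇒0≤q-p upper
    0<b = ℚ.<-≤-trans (*-pos (ℚ.positive⁻¹ 8) 0<a) 8a≤b
    8b≤c = ≤-by-certificate (*-pos 0<2+x 0<2+x) (P-lower-identity x a b c rec)
      (*-nonNeg (*-nonNeg (ℚ.nonNegative⁻¹ 8) 0≤1+x)
                (ℚ.+-mono-≤ (*-nonNeg (ℚ.+-mono-≤ (ℚ.nonNegative⁻¹ 3) (*-nonNeg (ℚ.nonNegative⁻¹ 2) 0≤x)) 0≤t)
                            (*-nonNeg (ℚ.nonNegative⁻¹ 8) 0≤a)))
    upper′ = ≤-by-certificate (*-pos (*-pos 0<2+x 0<2+x) 0<2+x) (P-upper-identity x a b c rec)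
      (ℚ.+-mono-≤ (*-nonNeg (*-nonNeg (*-nonNeg (ℚ.nonNegative⁻¹ 8) 0≤1+x)
                                      (ℚ.+-mono-≤ (ℚ.+-mono-≤ (*-nonNeg 0≤1+x 0≤1+x)
                                                              (*-nonNeg (ℚ.nonNegative⁻¹ 3) 0≤1+x))
                                                  (ℚ.nonNegative⁻¹ 1)))
                            0≤s)
                  (*-nonNeg (*-nonNeg (*-nonNeg (ℚ.nonNegative⁻¹ 128) 0≤1+x) 0≤1+x) 0≤a))

  V-ratioBounds-step : ∀ {a b c} → V-Recurrence x a b c → V-RatioBounds x a b → V-RatioBounds (1 + x) b c
  V-ratioBounds-step {a} {b} {c} rec (0<a , 16a<b , upper) = 0<b , 16b<c , upper′
    where
    0≤t = p≤q⇒0≤q-p (ℚ.<⇒≤ 16a<b)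
    0≤s = p≤q⇒0≤q-p upper
    0<b = ℚ.≤-<-trans (*-nonNeg (ℚ.nonNegative⁻¹ 16) (ℚ.<⇒≤ 0<a)) 16a<b
    0<[2+x]² = *-pos 0<2+x 0<2+x
    0≤[2+x]² = ℚ.<⇒≤ 0<[2+x]²
    0≤x[2+x] = *-nonNeg 0≤x 0≤2+x
    16b<c = <-by-certificate (*-pos 0<1+x 0<[2+x]²) (V-lower-identity x a b c rec)
      (ℚ.+-mono-≤-< (*-nonNeg (*-nonNeg (*-nonNeg (ℚ.nonNegative⁻¹ 8) 0≤x) 0≤[2+x]²) 0≤t)
                    (*-pos (ℚ.positive⁻¹ 8) 0<b))
    upper′ = ≤-by-certificate (*-pos 0<1+x (*-pos 0<1+x 0<[2+x]²)) (V-upper-identity x a b c rec)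
      (ℚ.+-mono-≤ (*-nonNeg (*-nonNeg (ℚ.nonNegative⁻¹ 8)
                                      (ℚ.+-mono-≤ (ℚ.+-mono-≤ (*-nonNeg 0≤x[2+x] 0≤x[2+x])
                                                              (*-nonNeg 0≤x (ℚ.+-mono-≤ (ℚ.nonNegative⁻¹ 5) 0≤x)))
                                                  (ℚ.nonNegative⁻¹ 5)))
                            (ℚ.<⇒≤ 0<b))
                  (*-nonNeg (*-nonNeg (*-nonNeg (*-nonNeg (ℚ.nonNegative⁻¹ 8) 0≤x) 0≤[2+x]²) (ℚ.<⇒≤ 0<3+x)) 0≤s))

geometricBound-step : ∀ {x r R a b} → 0 < x → 0 ≤ r →
  x * (2 + x) * b ≤ r * ((1 + x) * (1 + x)) * a → (1 + x) * a ≤ x * R →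
  (1 + (1 + x)) * b ≤ (1 + x) * (r * R)
geometricBound-step {x} {r} {R} {a} {b} 0<x 0≤r ratio bound = ℚ.*-cancelˡ-≤-pos x {{positive 0<x}} (begin
  x * ((1 + (1 + x)) * b)      ≡⟨ solve (x ∷ b ∷ []) ℚ-ring ⟩
  x * (2 + x) * b              ≤⟨ ratio ⟩
  r * ((1 + x) * (1 + x)) * a  ≡⟨ solve (x ∷ r ∷ a ∷ []) ℚ-ring ⟩
  r * (1 + x) * ((1 + x) * a)  ≤⟨ ℚ.*-monoˡ-≤-nonNeg (r * (1 + x)) {{nonNegative 0≤r[1+x]}} bound ⟩
  r * (1 + x) * (x * R)        ≡⟨ solve (x ∷ r ∷ R ∷ []) ℚ-ring ⟩
  x * ((1 + x) * (r * R))      ∎)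
  where
  open ℚ.≤-Reasoning
  0≤r[1+x] = *-nonNeg 0≤r (ℚ.+-mono-≤ (ℚ.nonNegative⁻¹ 1) (ℚ.<⇒≤ 0<x))

[1+x]a≤xR⇒a<R : ∀ {x a R} → 0 ≤ x → 0 < R → (1 + x) * a ≤ x * R → a < R
[1+x]a≤xR⇒a<R {x} {a} {R} 0≤x 0<R bound = ℚ.*-cancelˡ-<-nonNeg (1 + x) {{nonNegative 0≤1+x}} (begin-strict
  (1 + x) * a  ≤⟨ bound ⟩
  x * R        ≡⟨ ℚ.+-identityˡ (x * R) ⟨
  0 + x * R    <⟨ ℚ.+-monoˡ-< (x * R) 0<R ⟩
  R + x * R    ≡⟨ solve (x ∷ R ∷ []) ℚ-ring ⟩
  (1 + x) * R  ∎)
  where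
  open ℚ.≤-Reasoning
  0≤1+x = ℚ.+-mono-≤ (ℚ.nonNegative⁻¹ 1) 0≤x

P-ratioBounds : ∀ n → P-RatioBounds ⟦ n ⟧ (P n) (P (suc n))
P-ratioBounds zero    = ℚ.positive⁻¹ 1 , ℚ.≤ᵇ⇒≤ tt , ℚ.≤ᵇ⇒≤ tt
P-ratioBounds (suc n) = subst (λ y → P-RatioBounds y (P (suc n)) (P (suc (suc n)))) (sym (⟦suc⟧ n))
  (P-ratioBounds-step (⟦⟧-nonNeg n) (P-rec n) (P-ratioBounds n))

V-ratioBounds : ∀ n → V-RatioBounds ⟦ suc n ⟧ (V (suc n)) (V (suc (suc n)))
V-ratioBounds zero    = ℚ.positive⁻¹ 8 , from-yes (16 * V 1 ℚ.<? V 2) , ℚ.≤ᵇ⇒≤ tt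
V-ratioBounds (suc n) =
  subst (λ y → V-RatioBounds y (V (suc (suc n))) (V (suc (suc (suc n))))) (sym (⟦suc⟧ (suc n)))
  (V-ratioBounds-step (⟦⟧-nonNeg (suc n)) (V-rec (suc n)) (V-ratioBounds n))

-- The telescoped product of the upper ratio bounds, anchored at V 1 = 8.
V-geometricBound : ∀ n → (1 + ⟦ suc n ⟧) * V (suc n) ≤ ⟦ suc n ⟧ * 16 ^ℚ suc n
V-geometricBound zero    = ℚ.≤ᵇ⇒≤ tt
V-geometricBound (suc n) =
  subst (λ y → (1 + y) * V (suc (suc n)) ≤ y * 16 ^ℚ suc (suc n)) (sym (⟦suc⟧ (suc n)))
  (geometricBound-step (⟦suc⟧-pos n) (ℚ.nonNegative⁻¹ 16)
    (proj₂ (proj₂ (V-ratioBounds n))) (V-geometricBound n))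

proposition4p1 : RootStrictlyIncreasing P × RootStrictlyIncreasing V
proposition4p1 =
  logConvex⇒RootStrictlyIncreasing P ℚ.≤-refl (proj₁ ∘ P-ratioBounds) P-logConvex ,
  root<r≤ratio⇒RootStrictlyIncreasing V (ℚ.nonNegative⁻¹ 16) (proj₁ ∘ V-ratioBounds) V-below V-ratio≥16
  where
  P-logConvex : ∀ n → P (suc n) * P (suc n) < P n * P (suc (suc n))
  P-logConvex n = P-logConvex-step (⟦⟧-nonNeg n) (P-rec n) (P-ratioBounds n)
  V-below : ∀ n → V (suc n) < 16 ^ℚ suc n
  V-below n = [1+x]a≤xR⇒a<R (⟦⟧-nonNeg (suc n)) (^ℚ-pos (suc n) (ℚ.positive⁻¹ 16)) (V-geometricBound n)
  V-ratio≥16 : ∀ n → 16 * V (suc n) ≤ V (suc (suc n))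
  V-ratio≥16 n = ℚ.<⇒≤ (proj₁ (proj₂ (V-ratioBounds n)))
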